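{- Let $G = (A, B, E)$ be a bipartite graph, $\pi$ an arbitrarily ordered stream of its edges, $p \in (0,1]$, and $d$ a positive integer. Let $A' \subseteq A$ be a random subset such that each $a \in A$ is included independently with $\Pr[a \in A'] = p$. Let $H = G[A' \cup B]$ and denote by $\pi_H$ the substream of $\pi$ consisting of the edges of $H$. Then \[\mathbb{E}_{A'}\big[|\textsc{Greedy}_d(\pi_H)|\big] \geq \frac{d }{d + p} \cdot p \cdot \mu(G) \ .\]
   Context: $\mu(G)$ denotes the size of a maximum matching of $G$. For a subgraph $S$ and vertex $v$, $\deg_S(v)$ is the degree of $v$ in $S$. $\textsc{Greedy}_d$ on a stream of edges of a bipartite graph with sides $A$ and $B$ starts with $S=\emptyset$ and processes edges $ab$ ($a\in A$, $b\in B$) in stream order, adding $ab$ to $S$ if and only if $\deg_S(a)=0$ and $\deg_S(b)<d$; it returns $S$ (so every $A$-vertex has degree at most $1$ and every $B$-vertex degree at most $d$ in $S$).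
   Formalization: The probability p takes only rational values in (0,1]. -}

module Defs where

open import Data.Nat using (ℕ; zero; suc; _<?_)
open import Data.Nat.Properties using (_≟_)
open import Data.Fin using (Fin)
import Data.Fin.Properties as FinP
open import Data.Bool using (Bool; true; false)
open import Data.Vec using (Vec; []; _∷_; lookup)
open import Data.List using (List; []; _∷_; length; filter; map; _++_; foldr)
open import Data.List.Membership.Propositional using (_∈_)
open import Data.List.Relation.Unary.Unique.Propositional using (Unique)
open import Data.Product using (_×_; _,_; proj₁; proj₂; ∃)
open import Data.Integer using (+_)
open import Data.Rational using (ℚ; _/_; _+_; _*_; _-_; 0ℚ; 1ℚ)
open import Relation.Nullary using (yes; no; ¬_)
open import Relation.Binary.PropositionalEquality using (_≡_; _≢_)
open import Data.Bool using () renaming (_≟_ to _≟B_)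

Edge : ℕ → ℕ → Set
Edge m n = Fin m × Fin n

-- A stream of the edges of G: a duplicate-free list of edges.
-- The graph G is the one whose edge set is the set of stream elements.
Stream : ℕ → ℕ → Set
Stream m n = List (Edge m n)

degA : ∀ {m n} → List (Edge m n) → Fin m → ℕ
degA S a = length (filter (λ e → proj₁ e FinP.≟ a) S)

degB : ∀ {m n} → List (Edge m n) → Fin n → ℕ
degB S b = length (filter (λ e → proj₂ e FinP.≟ b) S)

greedyFrom : ∀ {m n} → ℕ → List (Edge m n) → Stream m n → List (Edge m n)
greedyFrom d S [] = S
greedyFrom d S ((a , b) ∷ π) with degA S a ≟ 0 | degB S b <? d
... | yes _ | yes _ = greedyFrom d ((a , b) ∷ S) π
... | yes _ | no _  = greedyFrom d S π
... | no _  | _     = greedyFrom d S π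

Greedy : ∀ {m n} → ℕ → Stream m n → List (Edge m n)
Greedy d π = greedyFrom d [] π

record IsMatching {m n} (π : Stream m n) (M : List (Edge m n)) : Set where
  field
    unique    : Unique M
    edges     : ∀ {e} → e ∈ M → e ∈ π
    disjointA : ∀ {e f} → e ∈ M → f ∈ M → e ≢ f → proj₁ e ≢ proj₁ f
    disjointB : ∀ {e f} → e ∈ M → f ∈ M → e ≢ f → proj₂ e ≢ proj₂ f

IsMaxMatchingSize : ∀ {m n} → Stream m n → ℕ → Set
IsMaxMatchingSize π k =
  (∃ λ M → IsMatching π M × length M ≡ k) ×
  (∀ M → IsMatching π M → length M Data.Nat.≤ k)

AllSubsets : (m : ℕ) → List (Vec Bool m)
AllSubsets zero = [] ∷ []
AllSubsets (suc m) = map (true ∷_) (AllSubsets m) ++ map (false ∷_) (AllSubsets m)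

weight : ∀ {m} → ℚ → Vec Bool m → ℚ
weight p [] = 1ℚ
weight p (true ∷ s) = p * weight p s
weight p (false ∷ s) = (1ℚ - p) * weight p s

-- π_H: substream of edges of H = G[A' ∪ B], i.e. edges whose A-endpoint is in A'.
restrict : ∀ {m n} → Vec Bool m → Stream m n → Stream m n
restrict s π = filter (λ e → lookup s (proj₁ e) ≟B true) π

ℕtoℚ : ℕ → ℚ
ℕtoℚ k = (+ k) / 1

sumℚ : List ℚ → ℚ
sumℚ = foldr _+_ 0ℚ

expectedGreedy : ∀ {m n} → ℚ → ℕ → Stream m n → ℚ
expectedGreedy {m} p d π =
  sumℚ (map (λ s → weight p s * ℕtoℚ (length (Greedy d (restrict s π)))) (AllSubsets m))

-- Fix an edge ab of a maximum matching M. If a ∈ A′, the greedy run on π_H either matches a or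
-- saturates b, since otherwise it would have taken ab. When a ends unmatched its edges never
-- influenced the run, so b is saturated also in the run with a removed from A′; that run does not
-- depend on whether a ∈ A′, hence this case has probability at most p·Pr[b saturated]. Thus
-- p ≤ Pr[a matched] + p·Pr[b saturated]. Summing over M, the matched A-endpoints number at most
-- |Greedy| and the saturated B-endpoints at most |Greedy|/d, which gives dpμ ≤ (d + p)·E|Greedy|.
module Submission where

open import Defs
import Algebra.Properties.CommutativeSemigroup as CommSemigroupProperties
open import Data.Bool using (Bool; true; false) renaming (_≟_ to _≟B_)
open import Data.Empty using (⊥-elim)
open import Data.Fin using (Fin; zero; suc)
import Data.Fin.Properties as FinP
import Data.Integer as ℤ
import Data.Integer.Properties as ℤ
open import Data.Integer.Tactic.RingSolver using (solve-∀)
open import Data.List using (List; []; _∷_; [_]; map; _++_; filter; length)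
open import Data.List.Properties
  using (map-++; map-∘; map-cong; ++-assoc; filter-++; length-++; filter-some; filter-accept; filter-reject)
open import Data.List.Membership.Propositional using (_∈_)
open import Data.List.Membership.Propositional.Properties using (∈-filter⁺)
open import Data.List.Relation.Unary.All as All using (All; []; _∷_)
open import Data.List.Relation.Unary.AllPairs using (AllPairs; []; _∷_)
open import Data.List.Relation.Unary.Any using (here; there)
open import Data.List.Relation.Unary.Unique.Propositional using (Unique)
open import Data.Nat using (ℕ; zero; suc; z≤n; s≤s; _<?_)
import Data.Nat as ℕ
open import Data.Nat.ListAction using (sum)
open import Data.Nat.Properties using (_≟_)
import Data.Nat.Properties as ℕ
open import Data.Product using (_×_; _,_; proj₁; proj₂; ∃)
open import Data.Rational as ℚ using (ℚ; _+_; _*_; _-_; 0ℚ; 1ℚ; _≤_; _<_)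
open import Data.Rational.Literals using (fromℤ)
import Data.Rational.Properties as ℚ
import Data.Rational.Solver as ℚ-Solver
import Data.Rational.Unnormalised as ℚᵘ
import Data.Rational.Unnormalised.Properties as ℚᵘ
open import Data.Sum using (_⊎_; inj₁; inj₂)
open import Data.Vec using (Vec; []; _∷_; lookup; _[_]≔_)
open import Data.Vec.Properties using (lookup∘updateAt; lookup∘updateAt′)
open import Function using (_∘_; flip; const)
open import Level using (0ℓ)
open import Relation.Binary using (DecidableEquality)
open import Relation.Binary.PropositionalEquality
  using (_≡_; _≢_; refl; cong; cong₂; sym; trans; subst; module ≡-Reasoning)
open import Relation.Nullary using (Dec; yes; no; ¬_; ¬?; _×-dec_)
open import Relation.Unary using (Pred; Decidable)

ℕtoℚ≡fromℤ : ∀ k → ℕtoℚ k ≡ fromℤ (ℤ.+ k)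
ℕtoℚ≡fromℤ k = ℚ.normalize-coprime _

ℕtoℚ-+ : ∀ a b → ℕtoℚ (a ℕ.+ b) ≡ ℕtoℚ a + ℕtoℚ b
ℕtoℚ-+ a b rewrite ℕtoℚ≡fromℤ a | ℕtoℚ≡fromℤ b | ℕtoℚ≡fromℤ (a ℕ.+ b) =
  ℚ.toℚᵘ-injective (ℚᵘ.≃-trans
    (ℚᵘ.*≡* (trans (cong (ℤ._* (ℤ.+ 1 ℤ.* ℤ.+ 1)) (ℤ.pos-+ a b)) (unit-denominators (ℤ.+ a) (ℤ.+ b))))
    (ℚᵘ.≃-sym (ℚ.toℚᵘ-homo-+ (fromℤ (ℤ.+ a)) (fromℤ (ℤ.+ b)))))
  where
  unit-denominators : ∀ (x y : ℤ.ℤ) →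
    (x ℤ.+ y) ℤ.* (ℤ.+ 1 ℤ.* ℤ.+ 1) ≡ (x ℤ.* ℤ.+ 1 ℤ.+ y ℤ.* ℤ.+ 1) ℤ.* ℤ.+ 1
  unit-denominators = solve-∀

ℕtoℚ-* : ∀ a b → ℕtoℚ (a ℕ.* b) ≡ ℕtoℚ a * ℕtoℚ b
ℕtoℚ-* a b rewrite ℕtoℚ≡fromℤ a | ℕtoℚ≡fromℤ b | ℕtoℚ≡fromℤ (a ℕ.* b) =
  ℚ.toℚᵘ-injective (ℚᵘ.≃-trans
    (ℚᵘ.*≡* (trans (cong (ℤ._* (ℤ.+ 1 ℤ.* ℤ.+ 1)) (ℤ.pos-* a b)) (unit-denominators (ℤ.+ a) (ℤ.+ b))))
    (ℚᵘ.≃-sym (ℚ.toℚᵘ-homo-* (fromℤ (ℤ.+ a)) (fromℤ (ℤ.+ b)))))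
  where
  unit-denominators : ∀ (x y : ℤ.ℤ) → (x ℤ.* y) ℤ.* (ℤ.+ 1 ℤ.* ℤ.+ 1) ≡ (x ℤ.* y) ℤ.* ℤ.+ 1
  unit-denominators = solve-∀

ℕtoℚ-mono : ∀ {a b} → a ℕ.≤ b → ℕtoℚ a ≤ ℕtoℚ b
ℕtoℚ-mono {a} {b} a≤b rewrite ℕtoℚ≡fromℤ a | ℕtoℚ≡fromℤ b =
  ℚ.*≤* (ℤ.*-monoʳ-≤-nonNeg (ℤ.+ 1) (ℤ.+≤+ a≤b))

module _ where
  open ℚ-Solver.+-*-Solver

  lincomb-+ : ∀ a b x y z w → a * (x + y) + b * (z + w) ≡ (a * x + b * z) + (a * y + b * w)
  lincomb-+ = solve 6 (λ a b x y z w →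
    a :* (x :+ y) :+ b :* (z :+ w) := (a :* x :+ b :* z) :+ (a :* y :+ b :* w)) refl

  lincomb-* : ∀ a b c x y → a * (c * x) + b * (c * y) ≡ c * (a * x + b * y)
  lincomb-* = solve 5 (λ a b c x y → a :* (c :* x) :+ b :* (c :* y) := c :* (a :* x :+ b :* y)) refl

  lincomb-interchange : ∀ a b x y z w →
    a * (a * x + b * y) + b * (a * z + b * w) ≡ a * (a * x + b * z) + b * (a * y + b * w)
  lincomb-interchange = solve 6 (λ a b x y z w →
    a :* (a :* x :+ b :* y) :+ b :* (a :* z :+ b :* w) := a :* (a :* x :+ b :* z) :+ b :* (a :* y :+ b :* w)) refl

  +-*-interchange : ∀ p x y z w → (x + p * y) + (z + p * w) ≡ (x + z) + p * (y + w)
  +-*-interchange = solve 5 (λ p x y z w → (x :+ p :* y) :+ (z :+ p :* w) := (x :+ z) :+ p :* (y :+ w)) refl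

  *-distribˡ-+-swap : ∀ c p x y → c * (x + p * y) ≡ c * x + p * (c * y)
  *-distribˡ-+-swap = solve 4 (λ c p x y → c :* (x :+ p :* y) := c :* x :+ p :* (c :* y)) refl

  convex-idem : ∀ p x → p * x + (1ℚ - p) * x ≡ x
  convex-idem = solve 2 (λ p x → p :* x :+ (con 1ℚ :- p) :* x := x) refl

sumℚ-++ : ∀ xs ys → sumℚ (xs ++ ys) ≡ sumℚ xs + sumℚ ys
sumℚ-++ []       ys = sym (ℚ.+-identityˡ (sumℚ ys))
sumℚ-++ (x ∷ xs) ys = trans (cong (x +_) (sumℚ-++ xs ys)) (sym (ℚ.+-assoc x (sumℚ xs) (sumℚ ys)))

*-distribˡ-sumℚ : ∀ c xs → c * sumℚ xs ≡ sumℚ (map (c *_) xs)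
*-distribˡ-sumℚ c []       = ℚ.*-zeroʳ c
*-distribˡ-sumℚ c (x ∷ xs) = trans (ℚ.*-distribˡ-+ c x (sumℚ xs)) (cong (c * x +_) (*-distribˡ-sumℚ c xs))

𝟙 : ∀ {P : Set} → Dec P → ℕ
𝟙 (yes _) = 1
𝟙 (no _)  = 0

𝟙-no : ∀ {P : Set} (P? : Dec P) → ¬ P → 𝟙 P? ≡ 0
𝟙-no (yes p) ¬p = ⊥-elim (¬p p)
𝟙-no (no _)  _  = refl

𝟙-mono : ∀ {P Q : Set} (P? : Dec P) (Q? : Dec Q) → (P → Q) → 𝟙 P? ℕ.≤ 𝟙 Q?
𝟙-mono (yes _) (yes _) _   = ℕ.≤-refl
𝟙-mono (yes p) (no ¬q) P⇒Q = ⊥-elim (¬q (P⇒Q p))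
𝟙-mono (no _)  _       _   = z≤n

𝟙-≤-+ : ∀ {P Q R : Set} (P? : Dec P) (Q? : Dec Q) (R? : Dec R) → (P → Q ⊎ R) → 𝟙 P? ℕ.≤ 𝟙 Q? ℕ.+ 𝟙 R?
𝟙-≤-+ (no _)  _       _       _      = z≤n
𝟙-≤-+ (yes _) (yes _) _       _      = s≤s z≤n
𝟙-≤-+ (yes _) (no _)  (yes _) _      = s≤s z≤n
𝟙-≤-+ (yes p) (no ¬q) (no ¬r) P⇒Q⊎R with P⇒Q⊎R p
... | inj₁ q = ⊥-elim (¬q q)
... | inj₂ r = ⊥-elim (¬r r)

𝟙-0<-≤ : ∀ k → 𝟙 (0 ℕ.<? k) ℕ.≤ k
𝟙-0<-≤ zero    = z≤n
𝟙-0<-≤ (suc k) = s≤s z≤n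

*-𝟙-≤ : ∀ c k → c ℕ.* 𝟙 (c ℕ.≤? k) ℕ.≤ k
*-𝟙-≤ c k with c ℕ.≤? k
... | yes c≤k = ℕ.≤-trans (ℕ.≤-reflexive (ℕ.*-identityʳ c)) c≤k
... | no _    = ℕ.≤-trans (ℕ.≤-reflexive (ℕ.*-zeroʳ c)) z≤n

module _ {A : Set} where

  sum-map-+ : ∀ (f g : A → ℕ) xs → sum (map (λ x → f x ℕ.+ g x) xs) ≡ sum (map f xs) ℕ.+ sum (map g xs)
  sum-map-+ f g []       = refl
  sum-map-+ f g (x ∷ xs) = trans (cong (f x ℕ.+ g x ℕ.+_) (sum-map-+ f g xs))
                                 (+-interchange (f x) (g x) (sum (map f xs)) (sum (map g xs)))
    where open CommSemigroupProperties ℕ.+-commutativeSemigroup using () renaming (interchange to +-interchange)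

  sum-map-mono : ∀ {f g : A → ℕ} → (∀ x → f x ℕ.≤ g x) → ∀ xs → sum (map f xs) ℕ.≤ sum (map g xs)
  sum-map-mono f≤g []       = z≤n
  sum-map-mono f≤g (x ∷ xs) = ℕ.+-mono-≤ (f≤g x) (sum-map-mono f≤g xs)

  sum-map-zero : ∀ {f : A → ℕ} {xs} → All (λ x → f x ≡ 0) xs → sum (map f xs) ≡ 0
  sum-map-zero []             = refl
  sum-map-zero (fx≡0 ∷ fxs≡0) = cong₂ ℕ._+_ fx≡0 (sum-map-zero fxs≡0)

  *-distribˡ-sum : ∀ c (f : A → ℕ) xs → c ℕ.* sum (map f xs) ≡ sum (map (λ x → c ℕ.* f x) xs)
  *-distribˡ-sum c f []       = ℕ.*-zeroʳ c
  *-distribˡ-sum c f (x ∷ xs) = trans (ℕ.*-distribˡ-+ c (f x) _) (cong (c ℕ.* f x ℕ.+_) (*-distribˡ-sum c f xs))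

  AllPairs-map∈ : ∀ {R S : A → A → Set} {xs} → (∀ {x y} → x ∈ xs → y ∈ xs → R x y → S x y) →
                  AllPairs R xs → AllPairs S xs
  AllPairs-map∈ {xs = []}     R⇒S []           = []
  AllPairs-map∈ {xs = x ∷ xs} R⇒S (Rx∷ ∷ Rxs) =
    All.tabulate (λ y∈ → R⇒S (here refl) (there y∈) (All.lookup Rx∷ y∈))
      ∷ AllPairs-map∈ (λ x∈ y∈ → R⇒S (there x∈) (there y∈)) Rxs

-- degA and degB are definitionally the instances k = proj₁ and k = proj₂ of occurrences.
module _ {A B : Set} (_≟ᴮ_ : DecidableEquality B) (k : A → B) where

  occurrences : B → List A → ℕ
  occurrences b S = length (filter (λ x → k x ≟ᴮ b) S)

  occurrences-∷ : ∀ b x S → occurrences b (x ∷ S) ≡ 𝟙 (k x ≟ᴮ b) ℕ.+ occurrences b S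
  occurrences-∷ b x S with k x ≟ᴮ b
  ... | yes _ = refl
  ... | no _  = refl

  sum-𝟙-≤1 : ∀ b {M} → AllPairs (λ e f → k e ≢ k f) M → sum (map (λ e → 𝟙 (b ≟ᴮ k e)) M) ℕ.≤ 1
  sum-𝟙-≤1 b []                      = z≤n
  sum-𝟙-≤1 b {e ∷ M} (ke≢ ∷ distinct) with b ≟ᴮ k e
  ... | yes refl = ℕ.≤-reflexive (cong suc (sum-map-zero (All.map (𝟙-no (k e ≟ᴮ k _)) ke≢)))
  ... | no _     = sum-𝟙-≤1 b distinct

  sum-occurrences≤length : ∀ {M} → AllPairs (λ e f → k e ≢ k f) M → ∀ S →
                           sum (map (λ e → occurrences (k e) S) M) ℕ.≤ length S
  sum-occurrences≤length {M} distinct [] =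
    ℕ.≤-reflexive (sum-map-zero {f = λ e → occurrences (k e) []} {M} (All.tabulate (λ _ → refl)))
  sum-occurrences≤length {M} distinct (x ∷ S) = begin
    sum (map (λ e → occurrences (k e) (x ∷ S)) M)
      ≡⟨ cong sum (map-cong (λ e → occurrences-∷ (k e) x S) M) ⟩
    sum (map (λ e → 𝟙 (k x ≟ᴮ k e) ℕ.+ occurrences (k e) S) M)
      ≡⟨ sum-map-+ (λ e → 𝟙 (k x ≟ᴮ k e)) (λ e → occurrences (k e) S) M ⟩
    sum (map (λ e → 𝟙 (k x ≟ᴮ k e)) M) ℕ.+ sum (map (λ e → occurrences (k e) S) M)
      ≤⟨ ℕ.+-mono-≤ (sum-𝟙-≤1 (k x) distinct) (sum-occurrences≤length distinct S) ⟩
    suc (length S) ∎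
    where open ℕ.≤-Reasoning

module Expectation (p : ℚ) where

  -- Opaque, so that unification never unfolds the weighted sum.
  opaque
    E : ∀ {m} → (Vec Bool m → ℕ) → ℚ
    E {m} X = sumℚ (map (λ s → weight p s * ℕtoℚ (X s)) (AllSubsets m))

  opaque
    unfolding E

    E-cong : ∀ {m} {X Y : Vec Bool m → ℕ} → (∀ s → X s ≡ Y s) → E X ≡ E Y
    E-cong {m} X≗Y = cong sumℚ (map-cong (λ s → cong (λ k → weight p s * ℕtoℚ k) (X≗Y s)) (AllSubsets m))

    expectedGreedy≡E : ∀ {m n} d (π : Stream m n) →
                       expectedGreedy p d π ≡ E (λ s → length (Greedy d (restrict s π)))
    expectedGreedy≡E d π = refl

    E-[] : (X : Vec Bool 0 → ℕ) → E X ≡ ℕtoℚ (X [])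
    E-[] X = trans (ℚ.+-identityʳ _) (ℚ.*-identityˡ _)

    E-∷ : ∀ {m} (X : Vec Bool (suc m) → ℕ) →
          E X ≡ p * E (X ∘ (true ∷_)) + (1ℚ - p) * E (X ∘ (false ∷_))
    E-∷ {m} X = begin
        sumℚ (map F (map (true ∷_) L ++ map (false ∷_) L))
      ≡⟨ cong sumℚ (map-++ F (map (true ∷_) L) (map (false ∷_) L)) ⟩
        sumℚ (map F (map (true ∷_) L) ++ map F (map (false ∷_) L))
      ≡⟨ sumℚ-++ (map F (map (true ∷_) L)) (map F (map (false ∷_) L)) ⟩
        sumℚ (map F (map (true ∷_) L)) + sumℚ (map F (map (false ∷_) L))
      ≡⟨ cong₂ _+_ (branch true p (λ _ → refl)) (branch false (1ℚ - p) (λ _ → refl)) ⟩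
        p * E (X ∘ (true ∷_)) + (1ℚ - p) * E (X ∘ (false ∷_)) ∎
      where
      open ≡-Reasoning
      L : List (Vec Bool m)
      L = AllSubsets m
      F : Vec Bool (suc m) → ℚ
      F s = weight p s * ℕtoℚ (X s)
      branch : ∀ v c → (∀ (t : Vec Bool m) → weight p (v ∷ t) ≡ c * weight p t) →
               sumℚ (map F (map (v ∷_) L)) ≡ c * E {m} (λ t → X (v ∷ t))
      branch v c weight-∷ = begin
          sumℚ (map F (map (v ∷_) L))
        ≡⟨ cong sumℚ (sym (map-∘ L)) ⟩
          sumℚ (map (F ∘ (v ∷_)) L)
        ≡⟨ cong sumℚ (map-cong (λ t → trans (cong (_* ℕtoℚ (X (v ∷ t))) (weight-∷ t)) (ℚ.*-assoc c _ _)) L) ⟩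
          sumℚ (map (λ t → c * (weight p t * ℕtoℚ (X (v ∷ t)))) L)
        ≡⟨ cong sumℚ (map-∘ L) ⟩
          sumℚ (map (c *_) (map (λ t → weight p t * ℕtoℚ (X (v ∷ t))) L))
        ≡⟨ *-distribˡ-sumℚ c (map (λ t → weight p t * ℕtoℚ (X (v ∷ t))) L) ⟨
          c * E {m} (λ t → X (v ∷ t)) ∎

  E-+ : ∀ {m} (X Y : Vec Bool m → ℕ) → E (λ s → X s ℕ.+ Y s) ≡ E X + E Y
  E-+ {zero} X Y = begin
      E (λ s → X s ℕ.+ Y s)       ≡⟨ E-[] _ ⟩
      ℕtoℚ (X [] ℕ.+ Y [])        ≡⟨ ℕtoℚ-+ (X []) (Y []) ⟩
      ℕtoℚ (X []) + ℕtoℚ (Y [])   ≡⟨ cong₂ _+_ (E-[] X) (E-[] Y) ⟨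
      E X + E Y                   ∎
    where open ≡-Reasoning
  E-+ {suc m} X Y = begin
      E (λ s → X s ℕ.+ Y s)
    ≡⟨ E-∷ _ ⟩
      p * E (λ t → X₁ t ℕ.+ Y₁ t) + (1ℚ - p) * E (λ t → X₀ t ℕ.+ Y₀ t)
    ≡⟨ cong₂ (λ x y → p * x + (1ℚ - p) * y) (E-+ X₁ Y₁) (E-+ X₀ Y₀) ⟩
      p * (E X₁ + E Y₁) + (1ℚ - p) * (E X₀ + E Y₀)
    ≡⟨ lincomb-+ p (1ℚ - p) _ _ _ _ ⟩
      (p * E X₁ + (1ℚ - p) * E X₀) + (p * E Y₁ + (1ℚ - p) * E Y₀)
    ≡⟨ cong₂ _+_ (E-∷ X) (E-∷ Y) ⟨
      E X + E Y ∎
    where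
    open ≡-Reasoning
    X₁ X₀ Y₁ Y₀ : Vec Bool m → ℕ
    X₁ = X ∘ (true ∷_)
    X₀ = X ∘ (false ∷_)
    Y₁ = Y ∘ (true ∷_)
    Y₀ = Y ∘ (false ∷_)

  E-scale : ∀ {m} c (X : Vec Bool m → ℕ) → E (λ s → c ℕ.* X s) ≡ ℕtoℚ c * E X
  E-scale {zero} c X = trans (E-[] _) (trans (ℕtoℚ-* c (X [])) (cong (ℕtoℚ c *_) (sym (E-[] X))))
  E-scale {suc m} c X = begin
      E (λ s → c ℕ.* X s)
    ≡⟨ E-∷ _ ⟩
      p * E (λ t → c ℕ.* X (true ∷ t)) + (1ℚ - p) * E (λ t → c ℕ.* X (false ∷ t))
    ≡⟨ cong₂ (λ x y → p * x + (1ℚ - p) * y) (E-scale c _) (E-scale c _) ⟩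
      p * (ℕtoℚ c * E (X ∘ (true ∷_))) + (1ℚ - p) * (ℕtoℚ c * E (X ∘ (false ∷_)))
    ≡⟨ lincomb-* p (1ℚ - p) (ℕtoℚ c) _ _ ⟩
      ℕtoℚ c * (p * E (X ∘ (true ∷_)) + (1ℚ - p) * E (X ∘ (false ∷_)))
    ≡⟨ cong (ℕtoℚ c *_) (E-∷ X) ⟨
      ℕtoℚ c * E X ∎
    where open ≡-Reasoning

  E-const : ∀ {m} k → E {m} (λ _ → k) ≡ ℕtoℚ k
  E-const {zero} k = E-[] _
  E-const {suc m} k = begin
      E {suc m} (λ _ → k)                           ≡⟨ E-∷ _ ⟩
      p * E {m} (λ _ → k) + (1ℚ - p) * E (λ _ → k)  ≡⟨ cong (λ x → p * x + (1ℚ - p) * x) (E-const k) ⟩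
      p * ℕtoℚ k + (1ℚ - p) * ℕtoℚ k               ≡⟨ convex-idem p (ℕtoℚ k) ⟩
      ℕtoℚ k                                        ∎
    where open ≡-Reasoning

  E-set : ∀ {m} (a : Fin m) (X : Vec Bool m → ℕ) →
          E X ≡ p * E (λ t → X (t [ a ]≔ true)) + (1ℚ - p) * E (λ t → X (t [ a ]≔ false))
  E-set zero X = trans (E-∷ X) (sym (cong₂ (λ x y → p * x + (1ℚ - p) * y) (fixed true) (fixed false)))
    where
    fixed : ∀ v → E (λ t → X (t [ zero ]≔ v)) ≡ E (λ t → X (v ∷ t))
    fixed v = trans (E-∷ _) (convex-idem p _)
  E-set (suc a) X = begin
      E X
    ≡⟨ E-∷ X ⟩
      p * E X₁ + (1ℚ - p) * E X₀
    ≡⟨ cong₂ (λ x y → p * x + (1ℚ - p) * y) (E-set a X₁) (E-set a X₀) ⟩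
      p * (p * E (λ t → X₁ (t [ a ]≔ true)) + (1ℚ - p) * E (λ t → X₁ (t [ a ]≔ false)))
        + (1ℚ - p) * (p * E (λ t → X₀ (t [ a ]≔ true)) + (1ℚ - p) * E (λ t → X₀ (t [ a ]≔ false)))
    ≡⟨ lincomb-interchange p (1ℚ - p) _ _ _ _ ⟩
      p * (p * E (λ t → X₁ (t [ a ]≔ true)) + (1ℚ - p) * E (λ t → X₀ (t [ a ]≔ true)))
        + (1ℚ - p) * (p * E (λ t → X₁ (t [ a ]≔ false)) + (1ℚ - p) * E (λ t → X₀ (t [ a ]≔ false)))
    ≡⟨ cong₂ (λ x y → p * x + (1ℚ - p) * y) (E-∷ _) (E-∷ _) ⟨
      p * E (λ t → X (t [ suc a ]≔ true)) + (1ℚ - p) * E (λ t → X (t [ suc a ]≔ false)) ∎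
    where
    open ≡-Reasoning
    X₁ X₀ : Vec Bool _ → ℕ
    X₁ t = X (true ∷ t)
    X₀ t = X (false ∷ t)

  E-member : ∀ {m} (a : Fin m) → E (λ s → 𝟙 (lookup s a ≟B true)) ≡ p
  E-member a = begin
      E (present a)
    ≡⟨ E-set a (present a) ⟩
      p * E (λ t → present a (t [ a ]≔ true)) + (1ℚ - p) * E (λ t → present a (t [ a ]≔ false))
    ≡⟨ cong₂ (λ x y → p * x + (1ℚ - p) * y) (trans (E-cong (updated true)) (E-const 1))
                                              (trans (E-cong (updated false)) (E-const 0)) ⟩
      p * 1ℚ + (1ℚ - p) * 0ℚ
    ≡⟨ cong₂ _+_ (ℚ.*-identityʳ p) (ℚ.*-zeroʳ (1ℚ - p)) ⟩
      p + 0ℚ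
    ≡⟨ ℚ.+-identityʳ p ⟩
      p ∎
    where
    open ≡-Reasoning
    present : Fin _ → Vec Bool _ → ℕ
    present a s = 𝟙 (lookup s a ≟B true)
    updated : ∀ v t → present a (t [ a ]≔ v) ≡ 𝟙 (v ≟B true)
    updated v t = cong (λ w → 𝟙 (w ≟B true)) (lookup∘updateAt a t)

  module _ (0≤p : 0ℚ ≤ p) (p≤1 : p ≤ 1ℚ) where
    private instance
      p-nonNeg : ℚ.NonNegative p
      p-nonNeg = ℚ.nonNegative 0≤p
      1-p-nonNeg : ℚ.NonNegative (1ℚ - p)
      1-p-nonNeg = ℚ.nonNegative (ℚ.≤-trans (ℚ.≤-reflexive (sym (ℚ.+-inverseʳ p))) (ℚ.+-monoˡ-≤ (ℚ.- p) p≤1))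

    E-mono : ∀ {m} {X Y : Vec Bool m → ℕ} → (∀ s → X s ℕ.≤ Y s) → E X ≤ E Y
    E-mono {zero} {X} {Y} X≤Y = begin
      E X          ≡⟨ E-[] X ⟩
      ℕtoℚ (X [])  ≤⟨ ℕtoℚ-mono (X≤Y []) ⟩
      ℕtoℚ (Y [])  ≡⟨ E-[] Y ⟨
      E Y          ∎
      where open ℚ.≤-Reasoning
    E-mono {suc m} {X} {Y} X≤Y = begin
      E X
        ≡⟨ E-∷ X ⟩
      p * E (X ∘ (true ∷_)) + (1ℚ - p) * E (X ∘ (false ∷_))
        ≤⟨ ℚ.+-mono-≤ (ℚ.*-monoˡ-≤-nonNeg p (E-mono (X≤Y ∘ (true ∷_))))
                      (ℚ.*-monoˡ-≤-nonNeg (1ℚ - p) (E-mono (X≤Y ∘ (false ∷_)))) ⟩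
      p * E (Y ∘ (true ∷_)) + (1ℚ - p) * E (Y ∘ (false ∷_))
        ≡⟨ E-∷ Y ⟨
      E Y ∎
      where open ℚ.≤-Reasoning

    E-≤-p*E : ∀ {m} (a : Fin m) (W Y : Vec Bool m → ℕ) →
              (∀ t → W (t [ a ]≔ false) ≡ 0) → (∀ t v → W (t [ a ]≔ true) ℕ.≤ Y (t [ a ]≔ v)) →
              E W ≤ p * E Y
    E-≤-p*E a W Y W-absent W-present = begin
      E W
        ≡⟨ E-set a W ⟩
      p * E W₁ + (1ℚ - p) * E (λ t → W (t [ a ]≔ false))
        ≡⟨ cong (λ x → p * E W₁ + (1ℚ - p) * x) (trans (E-cong W-absent) (E-const 0)) ⟩
      p * E W₁ + (1ℚ - p) * 0ℚ
        ≡⟨ trans (cong (p * E W₁ +_) (ℚ.*-zeroʳ (1ℚ - p))) (ℚ.+-identityʳ (p * E W₁)) ⟩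
      p * E W₁
        ≤⟨ ℚ.*-monoˡ-≤-nonNeg p W₁≤Y ⟩
      p * E Y ∎
      where
      open ℚ.≤-Reasoning
      W₁ : Vec Bool _ → ℕ
      W₁ t = W (t [ a ]≔ true)
      W₁≤Y : E W₁ ≤ E Y
      W₁≤Y = begin
        E W₁
          ≡⟨ convex-idem p (E W₁) ⟨
        p * E W₁ + (1ℚ - p) * E W₁
          ≤⟨ ℚ.+-mono-≤ (ℚ.*-monoˡ-≤-nonNeg p (E-mono (λ t → W-present t true)))
                        (ℚ.*-monoˡ-≤-nonNeg (1ℚ - p) (E-mono (λ t → W-present t false))) ⟩
        p * E (λ t → Y (t [ a ]≔ true)) + (1ℚ - p) * E (λ t → Y (t [ a ]≔ false))
          ≡⟨ E-set a Y ⟨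
        E Y ∎

Matched : ∀ {m n} → List (Edge m n) → Fin m → Set
Matched S a = 0 ℕ.< degA S a

Saturated : ∀ {m n} → ℕ → List (Edge m n) → Fin n → Set
Saturated d S b = d ℕ.≤ degB S b

dropEdgesOf : ∀ {m n} → Fin m → Stream m n → Stream m n
dropEdgesOf a = filter (λ e → ¬? (proj₁ e FinP.≟ a))

restrict-absent : ∀ {m n} (s : Vec Bool m) a (π : Stream m n) →
                  restrict (s [ a ]≔ false) π ≡ dropEdgesOf a (restrict (s [ a ]≔ true) π)
restrict-absent s a [] = refl
restrict-absent s a ((x , y) ∷ π) with x FinP.≟ a
... | yes refl rewrite lookup∘updateAt x {const false} s | lookup∘updateAt x {const true} s =
  trans (restrict-absent s x π) (sym (filter-reject (λ e → ¬? (proj₁ e FinP.≟ x)) (λ x≢x → x≢x refl)))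
... | no x≢a rewrite lookup∘updateAt′ x a {const false} x≢a s | lookup∘updateAt′ x a {const true} x≢a s
  with lookup s x
...   | true  = trans (cong ((x , y) ∷_) (restrict-absent s a π)) (sym (filter-accept (λ e → ¬? (proj₁ e FinP.≟ a)) x≢a))
...   | false = restrict-absent s a π

module Greedy {m n : ℕ} (d : ℕ) where

  greedyFrom-extends : ∀ (S : List (Edge m n)) π → ∃ λ T → greedyFrom d S π ≡ T ++ S
  greedyFrom-extends S [] = [] , refl
  greedyFrom-extends S ((a , b) ∷ π) with degA S a ≟ 0 | degB S b <? d
  ... | yes _ | yes _ = let T , eq = greedyFrom-extends ((a , b) ∷ S) π
                        in T ++ [ (a , b) ] , trans eq (sym (++-assoc T [ (a , b) ] S))
  ... | yes _ | no _  = greedyFrom-extends S π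
  ... | no _  | _     = greedyFrom-extends S π

  greedyFrom-count-mono : ∀ {P : Pred (Edge m n) 0ℓ} (P? : Decidable P) S π →
                          length (filter P? S) ℕ.≤ length (filter P? (greedyFrom d S π))
  greedyFrom-count-mono P? S π with T , eq ← greedyFrom-extends S π = begin
    length (filter P? S)                         ≤⟨ ℕ.m≤n+m _ _ ⟩
    length (filter P? T) ℕ.+ length (filter P? S) ≡⟨ length-++ (filter P? T) ⟨
    length (filter P? T ++ filter P? S)          ≡⟨ cong length (filter-++ P? T S) ⟨
    length (filter P? (T ++ S))                  ≡⟨ cong (length ∘ filter P?) eq ⟨
    length (filter P? (greedyFrom d S π))        ∎
    where open ℕ.≤-Reasoning

  matched-mono : ∀ {S : List (Edge m n)} {a} π → Matched S a → Matched (greedyFrom d S π) a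
  matched-mono {S} {a} π = flip ℕ.<-≤-trans (greedyFrom-count-mono (λ e → proj₁ e FinP.≟ a) S π)

  saturated-mono : ∀ {S : List (Edge m n)} {b} π → Saturated d S b → Saturated d (greedyFrom d S π) b
  saturated-mono {S} {b} π = flip ℕ.≤-trans (greedyFrom-count-mono (λ e → proj₂ e FinP.≟ b) S π)

  matched-∷ : ∀ (S : List (Edge m n)) a b → Matched ((a , b) ∷ S) a
  matched-∷ S a b = filter-some (λ e → proj₁ e FinP.≟ a) (here refl)

  greedyFrom-maximal : ∀ (S : List (Edge m n)) {π a b} → (a , b) ∈ π →
                       Matched (greedyFrom d S π) a ⊎ Saturated d (greedyFrom d S π) b
  greedyFrom-maximal S {(x , y) ∷ π} x,y∈ with degA S x ≟ 0 | degB S y <? d | x,y∈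
  ... | yes _   | yes _  | here refl = inj₁ (matched-mono π (matched-∷ S x y))
  ... | yes _   | yes _  | there e∈  = greedyFrom-maximal ((x , y) ∷ S) e∈
  ... | yes _   | no y≮d | here refl = inj₂ (saturated-mono π (ℕ.≮⇒≥ y≮d))
  ... | yes _   | no _   | there e∈  = greedyFrom-maximal S e∈
  ... | no x≢0  | _      | here refl = inj₁ (matched-mono π (ℕ.n≢0⇒n>0 x≢0))
  ... | no _    | _      | there e∈  = greedyFrom-maximal S e∈

  greedyFrom-unmatched : ∀ a (S : List (Edge m n)) π → ¬ Matched (greedyFrom d S π) a →
                         greedyFrom d S π ≡ greedyFrom d S (dropEdgesOf a π)
  greedyFrom-unmatched a S [] _ = refl
  greedyFrom-unmatched a S ((x , y) ∷ π) unmatched with x FinP.≟ a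
  ... | yes refl
    with degA S x ≟ 0 | degB S y <? d
  ...   | yes _ | yes _ = ⊥-elim (unmatched (matched-mono π (matched-∷ S x y)))
  ...   | yes _ | no _  = greedyFrom-unmatched x S π unmatched
  ...   | no _  | _     = greedyFrom-unmatched x S π unmatched
  greedyFrom-unmatched a S ((x , y) ∷ π) unmatched
      | no x≢a
    with degA S x ≟ 0 | degB S y <? d
  ...   | yes _ | yes _ = greedyFrom-unmatched a ((x , y) ∷ S) π unmatched
  ...   | yes _ | no _  = greedyFrom-unmatched a S π unmatched
  ...   | no _  | _     = greedyFrom-unmatched a S π unmatched

module RandomGreedy {m n} (π : Stream m n) (p : ℚ) (0≤p : 0ℚ ≤ p) (p≤1 : p ≤ 1ℚ) (d : ℕ) where
  open Expectation p
  open Greedy {m} {n} d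

  G : Vec Bool m → List (Edge m n)
  G s = Greedy d (restrict s π)

  present? : ∀ (s : Vec Bool m) a → Dec (lookup s a ≡ true)
  present? s a = lookup s a ≟B true

  matched? : ∀ (s : Vec Bool m) a → Dec (Matched (G s) a)
  matched? s a = 0 ℕ.<? degA (G s) a

  saturated? : ∀ (s : Vec Bool m) b → Dec (Saturated d (G s) b)
  saturated? s b = d ℕ.≤? degB (G s) b

  blocked? : ∀ (s : Vec Bool m) a b → Dec (lookup s a ≡ true × ¬ Matched (G s) a × Saturated d (G s) b)
  blocked? s a b = present? s a ×-dec ¬? (matched? s a) ×-dec saturated? s b

  present⇒matched⊎blocked : ∀ {a b} → (a , b) ∈ π → ∀ (s : Vec Bool m) →
    𝟙 (present? s a) ℕ.≤ 𝟙 (matched? s a) ℕ.+ 𝟙 (blocked? s a b)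
  present⇒matched⊎blocked {a} {b} a,b∈π s = 𝟙-≤-+ (present? s a) (matched? s a) (blocked? s a b) cases
    where
    cases : lookup s a ≡ true → Matched (G s) a ⊎ (lookup s a ≡ true × ¬ Matched (G s) a × Saturated d (G s) b)
    cases a∈s with greedyFrom-maximal [] (∈-filter⁺ (λ e → lookup s (proj₁ e) ≟B true) a,b∈π a∈s) | matched? s a
    ... | _            | yes matched = inj₁ matched
    ... | inj₁ matched | no unmatched = ⊥-elim (unmatched matched)
    ... | inj₂ sat     | no unmatched = inj₂ (a∈s , unmatched , sat)

  G-absent : ∀ (t : Vec Bool m) a → ¬ Matched (G (t [ a ]≔ true)) a → G (t [ a ]≔ false) ≡ G (t [ a ]≔ true)
  G-absent t a unmatched = begin
    greedyFrom d [] (restrict (t [ a ]≔ false) π)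
      ≡⟨ cong (greedyFrom d []) (restrict-absent t a π) ⟩
    greedyFrom d [] (dropEdgesOf a (restrict (t [ a ]≔ true) π))
      ≡⟨ greedyFrom-unmatched a [] (restrict (t [ a ]≔ true) π) unmatched ⟨
    greedyFrom d [] (restrict (t [ a ]≔ true) π) ∎
    where open ≡-Reasoning

  blocked≤saturated : ∀ a b (t : Vec Bool m) v → 𝟙 (blocked? (t [ a ]≔ true) a b) ℕ.≤ 𝟙 (saturated? (t [ a ]≔ v) b)
  blocked≤saturated a b t true  = 𝟙-mono (blocked? (t [ a ]≔ true) a b) (saturated? (t [ a ]≔ true) b) (proj₂ ∘ proj₂)
  blocked≤saturated a b t false = 𝟙-mono (blocked? (t [ a ]≔ true) a b) (saturated? (t [ a ]≔ false) b)
    λ (_ , unmatched , sat) → subst (λ S → Saturated d S b) (sym (G-absent t a unmatched)) sat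

  blocked-absent : ∀ a b (t : Vec Bool m) → 𝟙 (blocked? (t [ a ]≔ false) a b) ≡ 0
  blocked-absent a b t = 𝟙-no (blocked? (t [ a ]≔ false) a b)
    λ (a∈ , _) → false≢true (trans (sym (lookup∘updateAt a t)) a∈)
    where
    false≢true : false ≢ true
    false≢true ()

  edge-bound : ∀ {a b} → (a , b) ∈ π → p ≤ E (λ s → 𝟙 (matched? s a)) + p * E (λ s → 𝟙 (saturated? s b))
  edge-bound {a} {b} a,b∈π = begin
    p                              ≡⟨ E-member a ⟨
    E (λ s → 𝟙 (present? s a))     ≤⟨ E-mono 0≤p p≤1 (present⇒matched⊎blocked a,b∈π) ⟩
    E (λ s → X s ℕ.+ W s)          ≡⟨ E-+ X W ⟩
    E X + E W                      ≤⟨ ℚ.+-monoʳ-≤ (E X) (E-≤-p*E 0≤p p≤1 a W Y (blocked-absent a b) (blocked≤saturated a b)) ⟩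
    E X + p * E Y                  ∎
    where
    open ℚ.≤-Reasoning
    X W Y : Vec Bool m → ℕ
    X s = 𝟙 (matched? s a)
    W s = 𝟙 (blocked? s a b)
    Y s = 𝟙 (saturated? s b)

  #matched #saturated : List (Edge m n) → Vec Bool m → ℕ
  #matched   M s = sum (map (λ e → 𝟙 (matched? s (proj₁ e))) M)
  #saturated M s = sum (map (λ e → 𝟙 (saturated? s (proj₂ e))) M)

  matching-bound : ∀ M → (∀ {e} → e ∈ M → e ∈ π) →
                   p * ℕtoℚ (length M) ≤ E (#matched M) + p * E (#saturated M)
  matching-bound [] _ = ℚ.≤-reflexive (begin-equality
    p * 0ℚ                       ≡⟨ ℚ.*-zeroʳ p ⟩
    0ℚ                           ≡⟨ ℚ.+-identityʳ 0ℚ ⟨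
    0ℚ + 0ℚ                      ≡⟨ cong (0ℚ +_) (ℚ.*-zeroʳ p) ⟨
    0ℚ + p * 0ℚ                  ≡⟨ cong₂ (λ x y → x + p * y) (E-const 0) (E-const 0) ⟨
    E (#matched []) + p * E (#saturated []) ∎)
    where open ℚ.≤-Reasoning
  matching-bound ((a , b) ∷ M) M⊆π = begin
    p * ℕtoℚ (suc (length M))
      ≡⟨ cong (p *_) (ℕtoℚ-+ 1 (length M)) ⟩
    p * (1ℚ + ℕtoℚ (length M))
      ≡⟨ trans (ℚ.*-distribˡ-+ p 1ℚ _) (cong (_+ p * ℕtoℚ (length M)) (ℚ.*-identityʳ p)) ⟩
    p + p * ℕtoℚ (length M)
      ≤⟨ ℚ.+-mono-≤ (edge-bound (M⊆π (here refl))) (matching-bound M (M⊆π ∘ there)) ⟩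
    (E X + p * E Y) + (E (#matched M) + p * E (#saturated M))
      ≡⟨ +-*-interchange p (E X) (E Y) _ _ ⟩
    (E X + E (#matched M)) + p * (E Y + E (#saturated M))
      ≡⟨ cong₂ (λ x y → x + p * y) (E-+ X (#matched M)) (E-+ Y (#saturated M)) ⟨
    E (#matched ((a , b) ∷ M)) + p * E (#saturated ((a , b) ∷ M)) ∎
    where
    open ℚ.≤-Reasoning
    X Y : Vec Bool m → ℕ
    X s = 𝟙 (matched? s a)
    Y s = 𝟙 (saturated? s b)

  #matched≤length : ∀ {M} → IsMatching π M → ∀ s → #matched M s ℕ.≤ length (G s)
  #matched≤length {M} isM s = ℕ.≤-trans
    (sum-map-mono (λ e → 𝟙-0<-≤ (degA (G s) (proj₁ e))) M)
    (sum-occurrences≤length FinP._≟_ proj₁ (AllPairs-map∈ (IsMatching.disjointA isM) (IsMatching.unique isM)) (G s))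

  d*#saturated≤length : ∀ {M} → IsMatching π M → ∀ s → d ℕ.* #saturated M s ℕ.≤ length (G s)
  d*#saturated≤length {M} isM s = begin
    d ℕ.* #saturated M s
      ≡⟨ *-distribˡ-sum d _ M ⟩
    sum (map (λ e → d ℕ.* 𝟙 (saturated? s (proj₂ e))) M)
      ≤⟨ sum-map-mono (λ e → *-𝟙-≤ d (degB (G s) (proj₂ e))) M ⟩
    sum (map (λ e → degB (G s) (proj₂ e)) M)
      ≤⟨ sum-occurrences≤length FinP._≟_ proj₂ distinct (G s) ⟩
    length (G s) ∎
    where
    open ℕ.≤-Reasoning
    distinct : AllPairs (λ e f → proj₂ e ≢ proj₂ f) M
    distinct = AllPairs-map∈ (IsMatching.disjointB isM) (IsMatching.unique isM)

  approximation : ∀ {M} → IsMatching π M → ℕtoℚ d * p * ℕtoℚ (length M) ≤ (ℕtoℚ d + p) * expectedGreedy p d π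
  approximation {M} isM = begin
    d′ * p * ℕtoℚ (length M)
      ≡⟨ ℚ.*-assoc d′ p _ ⟩
    d′ * (p * ℕtoℚ (length M))
      ≤⟨ ℚ.*-monoˡ-≤-nonNeg d′ (matching-bound M (IsMatching.edges isM)) ⟩
    d′ * (E (#matched M) + p * E (#saturated M))
      ≡⟨ *-distribˡ-+-swap d′ p _ _ ⟩
    d′ * E (#matched M) + p * (d′ * E (#saturated M))
      ≡⟨ cong (λ x → d′ * E (#matched M) + p * x) (E-scale d (#saturated M)) ⟨
    d′ * E (#matched M) + p * E (λ s → d ℕ.* #saturated M s)
      ≤⟨ ℚ.+-mono-≤ (ℚ.*-monoˡ-≤-nonNeg d′ (E-mono 0≤p p≤1 (#matched≤length isM)))
                    (ℚ.*-monoˡ-≤-nonNeg p (E-mono 0≤p p≤1 (d*#saturated≤length isM))) ⟩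
    d′ * E |G| + p * E |G|
      ≡⟨ ℚ.*-distribʳ-+ (E |G|) d′ p ⟨
    (d′ + p) * E |G|
      ≡⟨ cong ((d′ + p) *_) (expectedGreedy≡E d π) ⟨
    (d′ + p) * expectedGreedy p d π ∎
    where
    open ℚ.≤-Reasoning
    d′ : ℚ
    d′ = ℕtoℚ d
    |G| : Vec Bool m → ℕ
    |G| s = length (G s)
    instance
      d′-nonNeg : ℚ.NonNegative d′
      d′-nonNeg = ℚ.nonNegative (ℕtoℚ-mono {0} {d} z≤n)
      p-nonNeg : ℚ.NonNegative p
      p-nonNeg = ℚ.nonNegative 0≤p

lemma3 : ∀ (m n : ℕ) (π : Stream m n) → Unique π →
    (p : ℚ) → 0ℚ < p → p ≤ 1ℚ →
    (d : ℕ) → 1 Data.Nat.≤ d →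
    (μ : ℕ) → IsMaxMatchingSize π μ →
    ℕtoℚ d * p * ℕtoℚ μ ≤ (ℕtoℚ d + p) * expectedGreedy p d π
lemma3 m n π _ p 0<p p≤1 d _ μ ((M , isM , refl) , _) =
  RandomGreedy.approximation π p (ℚ.<⇒≤ 0<p) p≤1 d isM
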